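{- Let $J$ be the set of items in a bin, and suppose the bin is $\mu$-slacked for some $\varepsilon/8\le\mu\le\varepsilon$. Apply the following weight rounding to every item $i$ of $J$ and every $j\in[d]$: if $i$ is big, round $v_j(i)$ up to a positive multiple of $\varepsilon_1^2\varepsilon/8$; if $i$ is wide and non-dense, round $v_j(i)$ up to a positive multiple of $h(i)\varepsilon_1\varepsilon/8$; if $i$ is tall and non-dense, round $v_j(i)$ up to a positive multiple of $w(i)\varepsilon_1\varepsilon/8$; if $i$ is small and non-dense, round $v_j(i)$ up to a positive multiple of $w(i)h(i)\varepsilon/8$ (dense items are unchanged). Then the bin (with the same positions of items) is $(\mu-\varepsilon/8)$-slacked.
   Context: Items are $(2,d)$ items: rectangles of width $w(i)$, height $h(i)$ in $[0,1]$ with nonnegative weights $v_1(i),\dots,v_d(i)\le 1$, packed feasibly (axis-parallel, disjoint interiors) into the bin $[0,1]^2$. Standing parameters: $\varepsilon^{ -1}\in2\mathbb Z$, $\varepsilon\le1/8$; $\varepsilon_1^{ -1},\varepsilon_2^{ -1}\in\mathbb Z$, $\varepsilon_1\le\min(1/(4d+1),2\varepsilon/3)$, $\varepsilon_2\le\varepsilon\varepsilon_1^2/2$; all items are $(\varepsilon_2,\varepsilon_1)$-non-medium (none of $w,h,v_1,\dots,v_d$ lies in $(\varepsilon_2,\varepsilon_1]$). Big: $w,h>\varepsilon_1$; wide: $w>\varepsilon_1$, $h\le\varepsilon_2$; tall: $w\le\varepsilon_2$, $h>\varepsilon_1$; small: $w,h\le\varepsilon_2$. Dense: $w(i)h(i)=0$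 or $\max_jv_j(i)/(w(i)h(i))>1/\varepsilon_1^2$. A bin with item set $J$ is $\nu$-slacked if $\sum_{i\in J}v_j(i)\le1-\nu$ for all $j$, or $|J|=1$, or ($|J|=2$, both items dense, and $\max_jv_j(i)\le 1/2$ for both).
   Formalization: Item widths, heights and weights, the positions of the items in the bin, and the parameter μ take values in ℚ rather than in the reals. -}

module Defs where

open import Data.Nat as ℕ using (ℕ; zero; suc; NonZero)
open import Data.Integer using (+_)
open import Data.Rational using (ℚ; _+_; _*_; _-_; _/_; _≤_; _<_; 0ℚ; 1ℚ; ½)
open import Data.Fin using (Fin) renaming (zero to fzero; suc to fsuc)
open import Data.Product using (Σ; _×_; ∃)
open import Data.Sum using (_⊎_)
open import Relation.Binary.PropositionalEquality using (_≡_)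
open import Relation.Nullary using (¬_)

ℕ→ℚ : ℕ → ℚ
ℕ→ℚ k = + k / 1

∑ : (n : ℕ) → (Fin n → ℚ) → ℚ
∑ zero    f = 0ℚ
∑ (suc n) f = f fzero + ∑ n (λ i → f (fsuc i))

record Item (d : ℕ) : Set where
  constructor item
  field
    w : ℚ
    h : ℚ
    v : Fin d → ℚ
open Item public

ValidItem : ∀ {d} → Item d → Set
ValidItem i = (0ℚ ≤ w i) × (w i ≤ 1ℚ) × (0ℚ ≤ h i) × (h i ≤ 1ℚ)
            × (∀ j → (0ℚ ≤ v i j) × (v i j ≤ 1ℚ))

-- feasible packing of the items J : Fin n → Item d into [0,1]^2:
-- lower-left corners (x i, y i), axis-parallel, disjoint interiors
Packing : ∀ {d} (n : ℕ) → (Fin n → Item d) → Set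
Packing n J = Σ (Fin n → ℚ) λ x → Σ (Fin n → ℚ) λ y →
    (∀ i → (0ℚ ≤ x i) × (x i + w (J i) ≤ 1ℚ) × (0ℚ ≤ y i) × (y i + h (J i) ≤ 1ℚ))
  × (∀ i k → ¬ (i ≡ k) →
       (x i + w (J i) ≤ x k) ⊎ (x k + w (J k) ≤ x i)
     ⊎ (y i + h (J i) ≤ y k) ⊎ (y k + h (J k) ≤ y i))

NotIn : ℚ → ℚ → ℚ → Set
NotIn ε₂ ε₁ a = ¬ ((ε₂ < a) × (a ≤ ε₁))

NonMedium : ∀ {d} → ℚ → ℚ → Item d → Set
NonMedium ε₂ ε₁ i = NotIn ε₂ ε₁ (w i) × NotIn ε₂ ε₁ (h i) × (∀ j → NotIn ε₂ ε₁ (v i j))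

module Classes (ε₁ ε₂ : ℚ) {d : ℕ} (i : Item d) where
  Big Wide Tall Small : Set
  Big   = (ε₁ < w i) × (ε₁ < h i)
  Wide  = (ε₁ < w i) × (h i ≤ ε₂)
  Tall  = (w i ≤ ε₂) × (ε₁ < h i)
  Small = (w i ≤ ε₂) × (h i ≤ ε₂)

  -- w h = 0, or max_j v_j / (w h) > 1/ε₁² ; for w h > 0 the latter is
  -- written multiplicatively: some v_j > (w h)/ε₁², where 1/ε₁² = E₁² is
  -- supplied as the argument invε₁²
  Dense : ℚ → Set
  Dense invε₁² = (w i * h i ≡ 0ℚ) ⊎ ∃ λ j → invε₁² * (w i * h i) < v i j

RoundUp : ℚ → ℚ → ℚ → Set
RoundUp q a a' = Σ ℕ λ k → (1 ℕ.≤ k) × (a' ≡ ℕ→ℚ k * q) × (a ≤ a')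
               × (∀ m → 1 ℕ.≤ m → a ≤ ℕ→ℚ m * q → k ℕ.≤ m)

Slacked : ∀ {d} (invε₁² : ℚ) (ε₁ ε₂ : ℚ) (ν : ℚ) (n : ℕ) → (Fin n → Item d) → Set
Slacked {d} invε₁² ε₁ ε₂ ν n J =
    (∀ j → ∑ n (λ i → v (J i) j) ≤ 1ℚ - ν)
  ⊎ (n ≡ 1)
  ⊎ ((n ≡ 2) × (∀ i → Classes.Dense ε₁ ε₂ (J i) invε₁² × (∀ j → v (J i) j ≤ ½)))

Rounding : ∀ {d} (ε ε₁ ε₂ invε₁² : ℚ) → Item d → (Fin d → ℚ) → Set
Rounding ε ε₁ ε₂ invε₁² i v' =
    (Big → ∀ j → RoundUp (ε₁ * ε₁ * ε * (+ 1 / 8)) (v i j) (v' j))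
  × (Wide  → ¬ Dense invε₁² → ∀ j → RoundUp (h i * ε₁ * ε * (+ 1 / 8)) (v i j) (v' j))
  × (Tall  → ¬ Dense invε₁² → ∀ j → RoundUp (w i * ε₁ * ε * (+ 1 / 8)) (v i j) (v' j))
  × (Small → ¬ Dense invε₁² → ∀ j → RoundUp (w i * h i * ε * (+ 1 / 8)) (v i j) (v' j))
  × (¬ Big → Dense invε₁² → ∀ j → v' j ≡ v i j)
  where
    open Classes ε₁ ε₂ i

{-# OPTIONS --safe #-}

-- Rounding raises a weight of a non-dense item by at most one rounding step, and in every
-- size class that step is at most (ε/8)·w(i)·h(i); dense items are never big, so their
-- weights are not changed at all.  In a bin slacked by its weights, the j-th weight thus
-- grows by at most ε/8 times the total area of the items, which is at most 1 since they are
-- packed into the unit square.  That area bound is proved for rectangles clipped to an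
-- arbitrary box R, by induction on their number: the first rectangle, clipped to R, cuts R
-- into itself and four strips, and every other rectangle meets only the strips.

module Submission where

open import Defs
open import Data.Nat as ℕ using (ℕ; zero; suc)
open import Data.Nat.Properties using (n≮n)
open import Data.Nat.Divisibility using (_∣_)
open import Data.Integer as ℤ using (+_)
open import Data.Rational
open import Data.Rational.Properties
import Data.Rational.Unnormalised as ℚᵘ
import Data.Rational.Unnormalised.Properties as ℚᵘ
import Data.Integer.Properties as ℤ
open import Data.Integer.Tactic.RingSolver as ℤ-Solver using ()
open import Data.Fin using (Fin) renaming (zero to fzero; suc to fsuc)
open import Data.Fin.Properties using (any?; suc-injective)
open import Data.Product as Product using (_×_; _,_; proj₁; proj₂)
open import Data.Sum as Sum using (_⊎_; inj₁; inj₂)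
open import Data.Empty using (⊥-elim)
open import Function using (_∘_)
open import Level using (0ℓ)
open import Relation.Nullary using (¬_; yes; no; Dec)
open import Relation.Nullary.Decidable using (dec⇒maybe; _⊎-dec_)
open import Relation.Binary.PropositionalEquality
open import Algebra.Bundles using (Ring)
open import Algebra.Properties.Semiring.Sum (Ring.semiring +-*-ring)
  using (sum; ∑-distrib-+; *-distribˡ-sum)
open import Tactic.RingSolver using (solve-∀)
open import Tactic.RingSolver.Core.AlmostCommutativeRing
  using (AlmostCommutativeRing; fromCommutativeRing)

-- the solver can only cancel coefficients that it can decide to be zero
ℚ-ring : AlmostCommutativeRing 0ℓ 0ℓ
ℚ-ring = fromCommutativeRing +-*-commutativeRing (λ p → dec⇒maybe (0ℚ ≟ p))

p≤q⇒0≤q-p : ∀ {p q} → p ≤ q → 0ℚ ≤ q - p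
p≤q⇒0≤q-p {p} {q} p≤q = subst (_≤ q - p) (+-inverseʳ p) (+-monoˡ-≤ (- p) p≤q)

p≤p+q : ∀ {p q} → 0ℚ ≤ q → p ≤ p + q
p≤p+q {p} {q} 0≤q = subst (_≤ p + q) (+-identityʳ p) (+-monoʳ-≤ p 0≤q)

*-nonNeg : ∀ {p q} → 0ℚ ≤ p → 0ℚ ≤ q → 0ℚ ≤ p * q
*-nonNeg {p} {q} 0≤p 0≤q =
  nonNegative⁻¹ (p * q) {{nonNeg*nonNeg⇒nonNeg p {{nonNegative 0≤p}} q {{nonNegative 0≤q}}}}

*-mono-≤-nonNeg : ∀ {p q r s} → 0ℚ ≤ p → 0ℚ ≤ r → p ≤ q → r ≤ s → p * r ≤ q * s
*-mono-≤-nonNeg {p} {q} {r} {s} 0≤p 0≤r p≤q r≤s = ≤-trans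
  (*-monoʳ-≤-nonNeg r {{nonNegative 0≤r}} p≤q)
  (*-monoˡ-≤-nonNeg q {{nonNegative (≤-trans 0≤p p≤q)}} r≤s)

toℚᵘ-ℕ→ℚ : ∀ k → toℚᵘ (ℕ→ℚ k) ℚᵘ.≃ ℚᵘ.mkℚᵘ (+ k) 0
toℚᵘ-ℕ→ℚ k = toℚᵘ-fromℚᵘ (ℚᵘ.mkℚᵘ (+ k) 0)

ℕ→ℚ-suc : ∀ m → ℕ→ℚ (suc m) ≡ ℕ→ℚ m + 1ℚ
ℕ→ℚ-suc m = toℚᵘ-injective (begin
  toℚᵘ (ℕ→ℚ (suc m))               ≈⟨ toℚᵘ-ℕ→ℚ (suc m) ⟩
  ℚᵘ.mkℚᵘ (+ suc m) 0               ≈⟨ ℚᵘ.*≡* (suc-identity (+ m)) ⟩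
  ℚᵘ.mkℚᵘ (+ m) 0 ℚᵘ.+ ℚᵘ.1ℚᵘ      ≈⟨ ℚᵘ.+-cong (ℚᵘ.≃-sym (toℚᵘ-ℕ→ℚ m)) ℚᵘ.≃-refl ⟩
  toℚᵘ (ℕ→ℚ m) ℚᵘ.+ toℚᵘ 1ℚ        ≈⟨ ℚᵘ.≃-sym (toℚᵘ-homo-+ (ℕ→ℚ m) 1ℚ) ⟩
  toℚᵘ (ℕ→ℚ m + 1ℚ)                 ∎)
  where
  open ℚᵘ.≃-Reasoning
  suc-identity : ∀ x → (+ 1 ℤ.+ x) ℤ.* + 1 ≡ (x ℤ.* + 1 ℤ.+ + 1 ℤ.* + 1) ℤ.* + 1
  suc-identity = ℤ-Solver.solve-∀

ℕ→ℚ-* : ∀ a b → ℕ→ℚ (a ℕ.* b) ≡ ℕ→ℚ a * ℕ→ℚ b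
ℕ→ℚ-* a b = toℚᵘ-injective (begin
  toℚᵘ (ℕ→ℚ (a ℕ.* b))                      ≈⟨ toℚᵘ-ℕ→ℚ (a ℕ.* b) ⟩
  ℚᵘ.mkℚᵘ (+ (a ℕ.* b)) 0                    ≈⟨ ℚᵘ.*≡* (cong (ℤ._* + 1) (ℤ.pos-* a b)) ⟩
  ℚᵘ.mkℚᵘ (+ a) 0 ℚᵘ.* ℚᵘ.mkℚᵘ (+ b) 0      ≈⟨ ℚᵘ.*-cong (ℚᵘ.≃-sym (toℚᵘ-ℕ→ℚ a)) (ℚᵘ.≃-sym (toℚᵘ-ℕ→ℚ b)) ⟩
  toℚᵘ (ℕ→ℚ a) ℚᵘ.* toℚᵘ (ℕ→ℚ b)            ≈⟨ ℚᵘ.≃-sym (toℚᵘ-homo-* (ℕ→ℚ a) (ℕ→ℚ b)) ⟩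
  toℚᵘ (ℕ→ℚ a * ℕ→ℚ b)                      ∎)
  where open ℚᵘ.≃-Reasoning

0≤ℕ→ℚ : ∀ k → 0ℚ ≤ ℕ→ℚ k
0≤ℕ→ℚ k = nonNegative⁻¹ (ℕ→ℚ k) {{normalize-nonNeg k 1}}

p*n≡1⇒0≤p : ∀ p n → p * ℕ→ℚ n ≡ 1ℚ → 0ℚ ≤ p
p*n≡1⇒0≤p p n pn≡1 with ≤-total 0ℚ p
... | inj₁ 0≤p = 0≤p
... | inj₂ p≤0 = ⊥-elim (<-irrefl refl (begin-strict
  0ℚ           <⟨ positive⁻¹ 1ℚ ⟩
  1ℚ           ≡⟨ pn≡1 ⟨
  p * ℕ→ℚ n    ≤⟨ *-monoʳ-≤-nonNeg (ℕ→ℚ n) {{nonNegative (0≤ℕ→ℚ n)}} p≤0 ⟩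
  0ℚ * ℕ→ℚ n   ≡⟨ *-zeroˡ (ℕ→ℚ n) ⟩
  0ℚ           ∎))
  where open ≤-Reasoning

p*n≡1⇒n²*p²≡1 : ∀ p n → p * ℕ→ℚ n ≡ 1ℚ → ℕ→ℚ (n ℕ.* n) * (p * p) ≡ 1ℚ
p*n≡1⇒n²*p²≡1 p n pn≡1 = begin
  ℕ→ℚ (n ℕ.* n) * (p * p)          ≡⟨ cong (_* (p * p)) (ℕ→ℚ-* n n) ⟩
  ℕ→ℚ n * ℕ→ℚ n * (p * p)          ≡⟨ regroup (ℕ→ℚ n) p ⟩
  (p * ℕ→ℚ n) * (p * ℕ→ℚ n)        ≡⟨ cong₂ _*_ pn≡1 pn≡1 ⟩
  1ℚ                               ∎
  where
  open ≡-Reasoning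
  regroup : ∀ m p → m * m * (p * p) ≡ (p * m) * (p * m)
  regroup = solve-∀ ℚ-ring

∑≡sum : ∀ n (f : Fin n → ℚ) → ∑ n f ≡ sum f
∑≡sum zero    f = refl
∑≡sum (suc n) f = cong (_+_ (f fzero)) (∑≡sum n (f ∘ fsuc))

∑-+ : ∀ n (f g : Fin n → ℚ) → ∑ n (λ i → f i + g i) ≡ ∑ n f + ∑ n g
∑-+ n f g = begin
  ∑ n (λ i → f i + g i)    ≡⟨ ∑≡sum n _ ⟩
  sum (λ i → f i + g i)    ≡⟨ ∑-distrib-+ f g ⟩
  sum f + sum g            ≡⟨ cong₂ _+_ (∑≡sum n f) (∑≡sum n g) ⟨
  ∑ n f + ∑ n g            ∎
  where open ≡-Reasoning

*-∑ : ∀ n c (f : Fin n → ℚ) → c * ∑ n f ≡ ∑ n (λ i → c * f i)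
*-∑ n c f = begin
  c * ∑ n f                ≡⟨ cong (c *_) (∑≡sum n f) ⟩
  c * sum f                ≡⟨ *-distribˡ-sum c f ⟩
  sum (λ i → c * f i)      ≡⟨ ∑≡sum n _ ⟨
  ∑ n (λ i → c * f i)      ∎
  where open ≡-Reasoning

∑-cong : ∀ n {f g : Fin n → ℚ} → (∀ i → f i ≡ g i) → ∑ n f ≡ ∑ n g
∑-cong zero    f≡g = refl
∑-cong (suc n) f≡g = cong₂ _+_ (f≡g fzero) (∑-cong n (f≡g ∘ fsuc))

∑-mono-≤ : ∀ n {f g : Fin n → ℚ} → (∀ i → f i ≤ g i) → ∑ n f ≤ ∑ n g
∑-mono-≤ zero    f≤g = ≤-refl
∑-mono-≤ (suc n) f≤g = +-mono-≤ (f≤g fzero) (∑-mono-≤ n (f≤g ∘ fsuc))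

∑-excess-≤ : ∀ n {f g h : Fin n → ℚ} {μ e} → 0ℚ ≤ e → (∀ i → h i ≤ f i + e * g i) →
  ∑ n f ≤ 1ℚ - μ → ∑ n g ≤ 1ℚ → ∑ n h ≤ 1ℚ - (μ - e)
∑-excess-≤ n {f} {g} {h} {μ} {e} 0≤e h≤f+eg ∑f≤1-μ ∑g≤1 = begin
  ∑ n h                          ≤⟨ ∑-mono-≤ n h≤f+eg ⟩
  ∑ n (λ i → f i + e * g i)      ≡⟨ ∑-+ n f _ ⟩
  ∑ n f + ∑ n (λ i → e * g i)    ≡⟨ cong (_+_ (∑ n f)) (*-∑ n e g) ⟨
  ∑ n f + e * ∑ n g              ≤⟨ +-mono-≤ ∑f≤1-μ (*-monoˡ-≤-nonNeg e {{nonNegative 0≤e}} ∑g≤1) ⟩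
  (1ℚ - μ) + e * 1ℚ              ≡⟨ regroup μ e ⟩
  1ℚ - (μ - e)                   ∎
  where
  open ≤-Reasoning
  regroup : ∀ μ e → (1ℚ - μ) + e * 1ℚ ≡ 1ℚ - (μ - e)
  regroup = solve-∀ ℚ-ring

-- Clamping to an interval

clamp : ℚ → ℚ → ℚ → ℚ
clamp a b t = a ⊔ (t ⊓ b)

clamp-mono-≤ : ∀ a b {s t} → s ≤ t → clamp a b s ≤ clamp a b t
clamp-mono-≤ a b s≤t = ⊔-monoʳ-≤ a (⊓-monoˡ-≤ b s≤t)

lo≤clamp : ∀ a b t → a ≤ clamp a b t
lo≤clamp a b t = p≤p⊔q a (t ⊓ b)

clamp≤hi : ∀ {a b} t → a ≤ b → clamp a b t ≤ b
clamp≤hi {a} {b} t a≤b = ⊔-lub a≤b (p⊓q≤q t b)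

clamp-≤-cut : ∀ a {p b t} → t ≤ p → p ≤ b → clamp a b t ≡ clamp a p t
clamp-≤-cut a {p} {b} {t} t≤p p≤b =
  cong (a ⊔_) (trans (p≤q⇒p⊓q≡p (≤-trans t≤p p≤b)) (sym (p≤q⇒p⊓q≡p t≤p)))

clamp-≥-cut : ∀ {a p} b {t} → a ≤ p → p ≤ t → p ≤ b → clamp a b t ≡ clamp p b t
clamp-≥-cut {a} {p} b {t} a≤p p≤t p≤b =
  trans (p≤q⇒p⊔q≡q (≤-trans a≤p p≤t⊓b)) (sym (p≤q⇒p⊔q≡q p≤t⊓b))
  where
  p≤t⊓b : p ≤ t ⊓ b
  p≤t⊓b = ⊓-glb p≤t p≤b

clamp-below : ∀ a b {t} → t ≤ a → clamp a b t ≡ a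
clamp-below a b {t} t≤a = p≥q⇒p⊔q≡p (≤-trans (p⊓q≤p t b) t≤a)

clamp-above : ∀ {a b t} → a ≤ b → b ≤ t → clamp a b t ≡ b
clamp-above {a} {b} {t} a≤b b≤t = trans (cong (a ⊔_) (p≥q⇒p⊓q≡q b≤t)) (p≤q⇒p⊔q≡q a≤b)

clamp-inside : ∀ {a b t} → a ≤ t → t ≤ b → clamp a b t ≡ t
clamp-inside {a} a≤t t≤b = trans (cong (a ⊔_) (p≤q⇒p⊓q≡p t≤b)) (p≤q⇒p⊔q≡q a≤t)

clamp-split : ∀ {a p b} t → a ≤ p → p ≤ b → clamp a b t ≡ clamp a p t + clamp p b t - p
clamp-split {a} {p} {b} t a≤p p≤b with ≤-total t p
... | inj₁ t≤p = begin
  clamp a b t                        ≡⟨ clamp-≤-cut a t≤p p≤b ⟩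
  clamp a p t                        ≡⟨ x≡x+p-p (clamp a p t) p ⟩
  clamp a p t + p - p                ≡⟨ cong (λ c → clamp a p t + c - p) (clamp-below p b t≤p) ⟨
  clamp a p t + clamp p b t - p      ∎
  where
  open ≡-Reasoning
  x≡x+p-p : ∀ x p → x ≡ x + p - p
  x≡x+p-p = solve-∀ ℚ-ring
... | inj₂ p≤t = begin
  clamp a b t                        ≡⟨ clamp-≥-cut b a≤p p≤t p≤b ⟩
  clamp p b t                        ≡⟨ x≡p+x-p (clamp p b t) p ⟩
  p + clamp p b t - p                ≡⟨ cong (λ c → c + clamp p b t - p) (clamp-above a≤p p≤t) ⟨
  clamp a p t + clamp p b t - p      ∎
  where
  open ≡-Reasoning
  x≡p+x-p : ∀ x p → x ≡ p + x - p
  x≡p+x-p = solve-∀ ℚ-ring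

-- the length of [x, y] ∩ [a, b], when x ≤ y and a ≤ b
overlapLength : ℚ → ℚ → ℚ → ℚ → ℚ
overlapLength a b x y = clamp a b y - clamp a b x

overlapLength-split : ∀ {a p b} x y → a ≤ p → p ≤ b → overlapLength a b x y ≡ overlapLength a p x y + overlapLength p b x y
overlapLength-split {a} {p} {b} x y a≤p p≤b = begin
  clamp a b y - clamp a b x
    ≡⟨ cong₂ _-_ (clamp-split y a≤p p≤b) (clamp-split x a≤p p≤b) ⟩
  (clamp a p y + clamp p b y - p) - (clamp a p x + clamp p b x - p)
    ≡⟨ regroup (clamp a p y) (clamp p b y) (clamp a p x) (clamp p b x) p ⟩
  overlapLength a p x y + overlapLength p b x y ∎
  where
  open ≡-Reasoning
  regroup : ∀ s t u v p → (s + t - p) - (u + v - p) ≡ (s - u) + (t - v)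
  regroup = solve-∀ ℚ-ring

overlapLength-split₃ : ∀ {a p q b} x y → a ≤ p → p ≤ q → q ≤ b →
  overlapLength a b x y ≡ overlapLength a p x y + (overlapLength p q x y + overlapLength q b x y)
overlapLength-split₃ {a} {p} x y a≤p p≤q q≤b = trans
  (overlapLength-split x y a≤p (≤-trans p≤q q≤b))
  (cong (_+_ (overlapLength a p x y)) (overlapLength-split x y p≤q q≤b))

overlapLength-inside : ∀ {a b x y} → a ≤ x → x ≤ y → y ≤ b → overlapLength a b x y ≡ y - x
overlapLength-inside a≤x x≤y y≤b =
  cong₂ _-_ (clamp-inside (≤-trans a≤x x≤y) y≤b) (clamp-inside a≤x (≤-trans x≤y y≤b))

module _ {a b u v : ℚ} (a≤b : a ≤ b) (u≤v : u ≤ v) where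

  clamp-clamp-below : ∀ {t} → t ≤ u → clamp (clamp a b u) (clamp a b v) t ≡ clamp a b u
  clamp-clamp-below {t} t≤u = p≥q⇒p⊔q≡p (begin
    t ⊓ clamp a b v   ≤⟨ ⊓-mono-≤ t≤u (clamp≤hi v a≤b) ⟩
    u ⊓ b             ≤⟨ p≤q⊔p a (u ⊓ b) ⟩
    clamp a b u       ∎)
    where open ≤-Reasoning

  clamp-clamp-above : ∀ {t} → v ≤ t → clamp (clamp a b u) (clamp a b v) t ≡ clamp a b v
  clamp-clamp-above {t} v≤t = begin
    u′ ⊔ (t ⊓ v′)          ≡⟨ ⊔-distribˡ-⊓ u′ t v′ ⟩
    (u′ ⊔ t) ⊓ (u′ ⊔ v′)   ≡⟨ cong ((u′ ⊔ t) ⊓_) (p≤q⇒p⊔q≡q (clamp-mono-≤ a b u≤v)) ⟩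
    (u′ ⊔ t) ⊓ v′          ≡⟨ p≥q⇒p⊓q≡q v′≤u′⊔t ⟩
    v′                     ∎
    where
    open ≡-Reasoning
    u′ v′ : ℚ
    u′ = clamp a b u
    v′ = clamp a b v
    v′≤u′⊔t : v′ ≤ u′ ⊔ t
    v′≤u′⊔t = ≤-trans (⊔-monoʳ-≤ a (≤-trans (p⊓q≤p v b) v≤t)) (⊔-monoˡ-≤ t (lo≤clamp a b u))

  overlapLength-clamped-below : ∀ {x y} → x ≤ y → y ≤ u → overlapLength (clamp a b u) (clamp a b v) x y ≡ 0ℚ
  overlapLength-clamped-below x≤y y≤u = trans
    (cong₂ _-_ (clamp-clamp-below y≤u) (clamp-clamp-below (≤-trans x≤y y≤u)))
    (+-inverseʳ (clamp a b u))

  overlapLength-clamped-above : ∀ {x y} → x ≤ y → v ≤ x → overlapLength (clamp a b u) (clamp a b v) x y ≡ 0ℚ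
  overlapLength-clamped-above x≤y v≤x = trans
    (cong₂ _-_ (clamp-clamp-above (≤-trans v≤x x≤y)) (clamp-clamp-above v≤x))
    (+-inverseʳ (clamp a b v))

-- Area of disjoint boxes

record Box : Set where
  constructor box
  field
    x₁ x₂ y₁ y₂ : ℚ
open Box

WellFormed : Box → Set
WellFormed B = x₁ B ≤ x₂ B × y₁ B ≤ y₂ B

_⊆_ : Box → Box → Set
P ⊆ R = x₁ R ≤ x₁ P × x₂ P ≤ x₂ R × y₁ R ≤ y₁ P × y₂ P ≤ y₂ R

Separated : Box → Box → Set
Separated B C = (x₂ B ≤ x₁ C) ⊎ (x₂ C ≤ x₁ B) ⊎ (y₂ B ≤ y₁ C) ⊎ (y₂ C ≤ y₁ B)

area : Box → ℚ
area B = (x₂ B - x₁ B) * (y₂ B - y₁ B)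

-- B ∩ R, a degenerate box of area zero when B and R are disjoint
clip : Box → Box → Box
clip R B = box (clamp (x₁ R) (x₂ R) (x₁ B)) (clamp (x₁ R) (x₂ R) (x₂ B))
               (clamp (y₁ R) (y₂ R) (y₁ B)) (clamp (y₁ R) (y₂ R) (y₂ B))

leftStrip rightStrip lowerStrip upperStrip : Box → Box → Box
leftStrip  R P = box (x₁ R) (x₁ P) (y₁ R) (y₂ R)
rightStrip R P = box (x₂ P) (x₂ R) (y₁ R) (y₂ R)
lowerStrip R P = box (x₁ P) (x₂ P) (y₁ R) (y₁ P)
upperStrip R P = box (x₁ P) (x₂ P) (y₂ P) (y₂ R)

frame : (Box → ℚ) → Box → Box → ℚ
frame f R P = f (leftStrip R P) + (f (rightStrip R P) + (f (lowerStrip R P) + f (upperStrip R P)))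

0≤area : ∀ {B} → WellFormed B → 0ℚ ≤ area B
0≤area (x₁≤x₂ , y₁≤y₂) = *-nonNeg (p≤q⇒0≤q-p x₁≤x₂) (p≤q⇒0≤q-p y₁≤y₂)

clip-wellFormed : ∀ R {B} → WellFormed B → WellFormed (clip R B)
clip-wellFormed R (x₁≤x₂ , y₁≤y₂) =
  clamp-mono-≤ (x₁ R) (x₂ R) x₁≤x₂ , clamp-mono-≤ (y₁ R) (y₂ R) y₁≤y₂

clip-⊆ : ∀ {R} B → WellFormed R → clip R B ⊆ R
clip-⊆ {R} B (x₁≤x₂ , y₁≤y₂) =
  lo≤clamp (x₁ R) (x₂ R) (x₁ B) , clamp≤hi (x₂ B) x₁≤x₂ , lo≤clamp (y₁ R) (y₂ R) (y₁ B) , clamp≤hi (y₂ B) y₁≤y₂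

area-decomposition : ∀ R P → area R ≡ area P + frame area R P
area-decomposition R P = identity (x₁ R) (x₂ R) (y₁ R) (y₂ R) (x₁ P) (x₂ P) (y₁ P) (y₂ P)
  where
  identity : ∀ a b c d p q r s →
    (b - a) * (d - c) ≡ (q - p) * (s - r) + ((p - a) * (d - c) + ((b - q) * (d - c) + ((q - p) * (r - c) + (q - p) * (d - s))))
  identity = solve-∀ ℚ-ring

area-clip-decomposition : ∀ {R P} B → WellFormed P → P ⊆ R →
  area (clip R B) ≡ area (clip P B) + frame (λ S → area (clip S B)) R P
area-clip-decomposition {R} {P} B (p≤q , r≤s) (a≤p , q≤b , c≤r , s≤d) = begin
  X * Y                                            ≡⟨ cong (_* Y) (overlapLength-split₃ (x₁ B) (x₂ B) a≤p p≤q q≤b) ⟩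
  (Xl + (Xm + Xr)) * Y                             ≡⟨ distribute Xl Xm Xr Y ⟩
  Xm * Y + (Xl * Y + Xr * Y)                       ≡⟨ cong (λ y → Xm * y + (Xl * Y + Xr * Y)) (overlapLength-split₃ (y₁ B) (y₂ B) c≤r r≤s s≤d) ⟩
  Xm * (Yl + (Ym + Yu)) + (Xl * Y + Xr * Y)       ≡⟨ regroup Xl Xm Xr Y Yl Ym Yu ⟩
  Xm * Ym + (Xl * Y + (Xr * Y + (Xm * Yl + Xm * Yu))) ∎
  where
  open ≡-Reasoning
  X Y Xl Xm Xr Yl Ym Yu : ℚ
  X = overlapLength (x₁ R) (x₂ R) (x₁ B) (x₂ B)
  Y = overlapLength (y₁ R) (y₂ R) (y₁ B) (y₂ B)
  Xl = overlapLength (x₁ R) (x₁ P) (x₁ B) (x₂ B)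
  Xm = overlapLength (x₁ P) (x₂ P) (x₁ B) (x₂ B)
  Xr = overlapLength (x₂ P) (x₂ R) (x₁ B) (x₂ B)
  Yl = overlapLength (y₁ R) (y₁ P) (y₁ B) (y₂ B)
  Ym = overlapLength (y₁ P) (y₂ P) (y₁ B) (y₂ B)
  Yu = overlapLength (y₂ P) (y₂ R) (y₁ B) (y₂ B)
  distribute : ∀ l m r y → (l + (m + r)) * y ≡ m * y + (l * y + r * y)
  distribute = solve-∀ ℚ-ring
  regroup : ∀ l m r y yl ym yu →
    m * (yl + (ym + yu)) + (l * y + r * y) ≡ m * ym + (l * y + (r * y + (m * yl + m * yu)))
  regroup = solve-∀ ℚ-ring

area-clip-zeroˣ : ∀ S B → overlapLength (x₁ S) (x₂ S) (x₁ B) (x₂ B) ≡ 0ℚ → area (clip S B) ≡ 0ℚ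
area-clip-zeroˣ S B X≡0 = trans (cong (_* Y) X≡0) (*-zeroˡ Y)
  where Y = overlapLength (y₁ S) (y₂ S) (y₁ B) (y₂ B)

area-clip-zeroʸ : ∀ S B → overlapLength (y₁ S) (y₂ S) (y₁ B) (y₂ B) ≡ 0ℚ → area (clip S B) ≡ 0ℚ
area-clip-zeroʸ S B Y≡0 = trans (cong (X *_) Y≡0) (*-zeroʳ X)
  where X = overlapLength (x₁ S) (x₂ S) (x₁ B) (x₂ B)

area-clip-separated : ∀ {R B₀ B} → WellFormed R → WellFormed B₀ → WellFormed B → Separated B₀ B →
  area (clip (clip R B₀) B) ≡ 0ℚ
area-clip-separated {R} {B₀} {B} (a≤b , _) (u≤v , _) (x≤x′ , _) (inj₁ x₂B₀≤x₁B) =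
  area-clip-zeroˣ (clip R B₀) B (overlapLength-clamped-above a≤b u≤v x≤x′ x₂B₀≤x₁B)
area-clip-separated {R} {B₀} {B} (a≤b , _) (u≤v , _) (x≤x′ , _) (inj₂ (inj₁ x₂B≤x₁B₀)) =
  area-clip-zeroˣ (clip R B₀) B (overlapLength-clamped-below a≤b u≤v x≤x′ x₂B≤x₁B₀)
area-clip-separated {R} {B₀} {B} (_ , c≤d) (_ , r≤s) (_ , y≤y′) (inj₂ (inj₂ (inj₁ y₂B₀≤y₁B))) =
  area-clip-zeroʸ (clip R B₀) B (overlapLength-clamped-above c≤d r≤s y≤y′ y₂B₀≤y₁B)
area-clip-separated {R} {B₀} {B} (_ , c≤d) (_ , r≤s) (_ , y≤y′) (inj₂ (inj₂ (inj₂ y₂B≤y₁B₀))) =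
  area-clip-zeroʸ (clip R B₀) B (overlapLength-clamped-below c≤d r≤s y≤y′ y₂B≤y₁B₀)

∑-frame : ∀ n (f : Fin n → Box → ℚ) R P → ∑ n (λ i → frame (f i) R P) ≡ frame (λ S → ∑ n (λ i → f i S)) R P
∑-frame n f R P = begin
  ∑ n (λ i → l i + (r i + (b i + t i)))      ≡⟨ ∑-+ n l _ ⟩
  ∑ n l + ∑ n (λ i → r i + (b i + t i))      ≡⟨ cong (_+_ (∑ n l)) (∑-+ n r _) ⟩
  ∑ n l + (∑ n r + ∑ n (λ i → b i + t i))    ≡⟨ cong (λ z → ∑ n l + (∑ n r + z)) (∑-+ n b t) ⟩
  ∑ n l + (∑ n r + (∑ n b + ∑ n t))          ∎
  where
  open ≡-Reasoning
  l r b t : Fin n → ℚ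
  l i = f i (leftStrip R P)
  r i = f i (rightStrip R P)
  b i = f i (lowerStrip R P)
  t i = f i (upperStrip R P)

frame-mono-≤ : ∀ {f g : Box → ℚ} {R P} → (∀ {S} → WellFormed S → f S ≤ g S) →
  WellFormed R → WellFormed P → P ⊆ R → frame f R P ≤ frame g R P
frame-mono-≤ f≤g (_ , c≤d) (p≤q , r≤s) (a≤p , q≤b , c≤r , s≤d) =
  +-mono-≤ (f≤g (a≤p , c≤d)) (+-mono-≤ (f≤g (q≤b , c≤d)) (+-mono-≤ (f≤g (p≤q , c≤r)) (f≤g (p≤q , s≤d))))

∑-area-clip≤area : ∀ n (B : Fin n → Box) → (∀ i → WellFormed (B i)) →
  (∀ i k → ¬ i ≡ k → Separated (B i) (B k)) →
  ∀ {R} → WellFormed R → ∑ n (λ i → area (clip R (B i))) ≤ area R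
∑-area-clip≤area zero    B wf separated wfR = 0≤area wfR
∑-area-clip≤area (suc n) B wf separated {R} wfR = begin
  area P + ∑ n (λ i → area (clip R (B′ i)))     ≤⟨ +-monoʳ-≤ (area P) others≤frame ⟩
  area P + frame area R P                      ≡⟨ area-decomposition R P ⟨
  area R                                       ∎
  where
  open ≤-Reasoning
  B′ : Fin n → Box
  B′ = B ∘ fsuc
  separated′ : ∀ i k → ¬ i ≡ k → Separated (B′ i) (B′ k)
  separated′ i k i≢k = separated (fsuc i) (fsuc k) (i≢k ∘ suc-injective)
  P : Box
  P = clip R (B fzero)
  wfP : WellFormed P
  wfP = clip-wellFormed R (wf fzero)
  P⊆R : P ⊆ R
  P⊆R = clip-⊆ (B fzero) wfR
  areaOf : Fin n → Box → ℚ
  areaOf i S = area (clip S (B′ i))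
  outside : ∀ i → areaOf i R ≤ frame (areaOf i) R P
  outside i = ≤-reflexive (begin-equality
    areaOf i R                             ≡⟨ area-clip-decomposition (B′ i) wfP P⊆R ⟩
    areaOf i P + frame (areaOf i) R P      ≡⟨ cong (_+ frame (areaOf i) R P) P∩B′ᵢ≡0 ⟩
    0ℚ + frame (areaOf i) R P              ≡⟨ +-identityˡ (frame (areaOf i) R P) ⟩
    frame (areaOf i) R P                   ∎)
    where
    P∩B′ᵢ≡0 : areaOf i P ≡ 0ℚ
    P∩B′ᵢ≡0 = area-clip-separated wfR (wf fzero) (wf (fsuc i)) (separated fzero (fsuc i) λ ())
  others≤frame : ∑ n (λ i → areaOf i R) ≤ frame area R P
  others≤frame = begin
    ∑ n (λ i → areaOf i R)                     ≤⟨ ∑-mono-≤ n outside ⟩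
    ∑ n (λ i → frame (areaOf i) R P)           ≡⟨ ∑-frame n areaOf R P ⟩
    frame (λ S → ∑ n (λ i → areaOf i S)) R P   ≤⟨ frame-mono-≤ (∑-area-clip≤area n B′ (wf ∘ fsuc) separated′) wfR wfP P⊆R ⟩
    frame area R P                             ∎

unitSquare : Box
unitSquare = box 0ℚ 1ℚ 0ℚ 1ℚ

packing-area≤1 : ∀ {d} n (J : Fin n → Item d) → (∀ i → ValidItem (J i)) → Packing n J →
  ∑ n (λ i → w (J i) * h (J i)) ≤ 1ℚ
packing-area≤1 n J valid (x , y , inside , separated) = begin
  ∑ n (λ i → w (J i) * h (J i))             ≡⟨ ∑-cong n area-placed ⟨
  ∑ n (λ i → area (clip unitSquare (B i)))  ≤⟨ ∑-area-clip≤area n B wf separated {unitSquare} (0≤1 , 0≤1) ⟩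
  area unitSquare                           ≡⟨⟩
  1ℚ                                        ∎
  where
  open ≤-Reasoning
  0≤1 : 0ℚ ≤ 1ℚ
  0≤1 = <⇒≤ (positive⁻¹ 1ℚ)
  B : Fin n → Box
  B i = box (x i) (x i + w (J i)) (y i) (y i + h (J i))
  wf : ∀ i → WellFormed (B i)
  wf i = p≤p+q (proj₁ (valid i)) , p≤p+q (proj₁ (proj₂ (proj₂ (valid i))))
  side : ∀ {s ℓ} → 0ℚ ≤ s → 0ℚ ≤ ℓ → s + ℓ ≤ 1ℚ → overlapLength 0ℚ 1ℚ s (s + ℓ) ≡ ℓ
  side {s} {ℓ} 0≤s 0≤ℓ s+ℓ≤1 = trans (overlapLength-inside 0≤s (p≤p+q 0≤ℓ) s+ℓ≤1) (s+ℓ-s≡ℓ s ℓ)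
    where
    s+ℓ-s≡ℓ : ∀ s ℓ → s + ℓ - s ≡ ℓ
    s+ℓ-s≡ℓ = solve-∀ ℚ-ring
  area-placed : ∀ i → area (clip unitSquare (B i)) ≡ w (J i) * h (J i)
  area-placed i with inside i | valid i
  ... | 0≤x , x+w≤1 , 0≤y , y+h≤1 | 0≤w , _ , 0≤h , _ = cong₂ _*_ (side 0≤x 0≤w x+w≤1) (side 0≤y 0≤h y+h≤1)

-- Weight rounding

roundUp≤+step : ∀ {q a a′} → 0ℚ ≤ a → RoundUp q a a′ → a′ ≤ a + q
roundUp≤+step {q} {a} {a′} 0≤a (suc zero , _ , a′≡1q , _ , _) = begin
  a′            ≡⟨ trans a′≡1q (*-identityˡ q) ⟩
  q             ≤⟨ subst (_≤ a + q) (+-identityˡ q) (+-monoˡ-≤ q 0≤a) ⟩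
  a + q         ∎
  where open ≤-Reasoning
roundUp≤+step {q} {a} {a′} _ (suc (suc m) , _ , a′≡kq , _ , minimal) = begin
  a′                         ≡⟨ a′≡kq ⟩
  ℕ→ℚ (suc (suc m)) * q      ≡⟨ cong (_* q) (ℕ→ℚ-suc (suc m)) ⟩
  (ℕ→ℚ (suc m) + 1ℚ) * q     ≡⟨ distrib (ℕ→ℚ (suc m)) q ⟩
  ℕ→ℚ (suc m) * q + q        ≤⟨ +-monoˡ-≤ q (<⇒≤ previous<a) ⟩
  a + q                      ∎
  where
  open ≤-Reasoning
  distrib : ∀ n q → (n + 1ℚ) * q ≡ n * q + q
  distrib = solve-∀ ℚ-ring
  previous<a : ℕ→ℚ (suc m) * q < a
  previous<a = ≰⇒> (λ a≤previous → n≮n (suc m) (minimal (suc m) (ℕ.s≤s ℕ.z≤n) a≤previous))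

roundUp≤+scaled : ∀ {s A ε k a a′} → 0ℚ ≤ a → 0ℚ ≤ ε * k → s ≤ A →
  RoundUp (s * ε * k) a a′ → a′ ≤ a + ε * k * A
roundUp≤+scaled {s} {A} {ε} {k} {a} 0≤a 0≤εk s≤A rounded = begin
  _                 ≤⟨ roundUp≤+step 0≤a rounded ⟩
  a + s * ε * k     ≡⟨ cong (_+_ a) (reorder s ε k) ⟩
  a + ε * k * s     ≤⟨ +-monoʳ-≤ a (*-monoˡ-≤-nonNeg (ε * k) {{nonNegative 0≤εk}} s≤A) ⟩
  a + ε * k * A     ∎
  where
  open ≤-Reasoning
  reorder : ∀ s ε k → s * ε * k ≡ ε * k * s
  reorder = solve-∀ ℚ-ring

small-or-large : ∀ {ε₂ ε₁ t} → NotIn ε₂ ε₁ t → t ≤ ε₂ ⊎ ε₁ < t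
small-or-large {ε₂} {ε₁} {t} notMedium with t ≤? ε₂ | t ≤? ε₁
... | yes t≤ε₂ | _        = inj₁ t≤ε₂
... | no  t≰ε₂ | yes t≤ε₁ = ⊥-elim (notMedium (≰⇒> t≰ε₂ , t≤ε₁))
... | no  _    | no  t≰ε₁ = inj₂ (≰⇒> t≰ε₁)

dense? : ∀ {d} ε₁ ε₂ K (i : Item d) → Dec (Classes.Dense ε₁ ε₂ i K)
dense? ε₁ ε₂ K i = (w i * h i ≟ 0ℚ) ⊎-dec any? (λ j → K * (w i * h i) <? v i j)

Dense⇒¬Big : ∀ {d ε₁ ε₂ K} (i : Item d) → 0ℚ ≤ ε₁ → 0ℚ ≤ K → K * (ε₁ * ε₁) ≡ 1ℚ → ValidItem i →
  Classes.Dense ε₁ ε₂ i K → ¬ Classes.Big ε₁ ε₂ i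
Dense⇒¬Big i 0≤ε₁ _ _ _ (inj₁ wh≡0) (ε₁<w , ε₁<h) = <⇒≢ 0<wh (sym wh≡0)
  where
  0<wh : 0ℚ < w i * h i
  0<wh = positive⁻¹ (w i * h i)
    {{pos*pos⇒pos (w i) {{positive (≤-<-trans 0≤ε₁ ε₁<w)}} (h i) {{positive (≤-<-trans 0≤ε₁ ε₁<h)}}}}
Dense⇒¬Big {ε₁ = ε₁} {K = K} i 0≤ε₁ 0≤K Kε₁²≡1 (_ , _ , _ , _ , v≤1) (inj₂ (j , Kwh<v)) (ε₁<w , ε₁<h) =
  <-irrefl refl (begin-strict
    1ℚ                 ≡⟨ Kε₁²≡1 ⟨
    K * (ε₁ * ε₁)      ≤⟨ *-monoˡ-≤-nonNeg K {{nonNegative 0≤K}} (*-mono-≤-nonNeg 0≤ε₁ 0≤ε₁ (<⇒≤ ε₁<w) (<⇒≤ ε₁<h)) ⟩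
    K * (w i * h i)    <⟨ Kwh<v ⟩
    v i j              ≤⟨ proj₂ (v≤1 j) ⟩
    1ℚ                 ∎)
  where open ≤-Reasoning

module _ {d : ℕ} {ε₁ ε₂ K : ℚ} (0≤ε₁ : 0ℚ ≤ ε₁) (0≤K : 0ℚ ≤ K) (Kε₁²≡1 : K * (ε₁ * ε₁) ≡ 1ℚ)
         {i : Item d} (valid : ValidItem i) where

  open Classes ε₁ ε₂ i

  private
    0≤w : 0ℚ ≤ w i
    0≤w = proj₁ valid
    0≤h : 0ℚ ≤ h i
    0≤h = proj₁ (proj₂ (proj₂ valid))
    0≤v : ∀ j → 0ℚ ≤ v i j
    0≤v j = proj₁ (proj₂ (proj₂ (proj₂ (proj₂ valid))) j)

  dense-rounding-unchanged : ∀ {ε v′} → Rounding ε ε₁ ε₂ K i v′ → Dense K → ∀ j → v′ j ≡ v i j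
  dense-rounding-unchanged (_ , _ , _ , _ , unchanged) isDense =
    unchanged (Dense⇒¬Big {ε₂ = ε₂} i 0≤ε₁ 0≤K Kε₁²≡1 valid isDense) isDense

  dense-light-rounding : ∀ {ε v′} → Rounding ε ε₁ ε₂ K i v′ → Dense K × (∀ j → v i j ≤ ½) →
    Classes.Dense ε₁ ε₂ (item (w i) (h i) v′) K × (∀ j → v′ j ≤ ½)
  dense-light-rounding {v′ = v′} rounding (isDense , light) =
    dense′ isDense , λ j → subst (_≤ ½) (sym (unchanged j)) (light j)
    where
    unchanged : ∀ j → v′ j ≡ v i j
    unchanged = dense-rounding-unchanged rounding isDense
    dense′ : Dense K → Classes.Dense ε₁ ε₂ (item (w i) (h i) v′) K
    dense′ (inj₁ wh≡0)       = inj₁ wh≡0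
    dense′ (inj₂ (j , heavy)) = inj₂ (j , subst (K * (w i * h i) <_) (sym (unchanged j)) heavy)

  rounding-excess : ∀ {ε v′} → 0ℚ ≤ ε * (+ 1 / 8) → NonMedium ε₂ ε₁ i → Rounding ε ε₁ ε₂ K i v′ →
    ∀ j → v′ j ≤ v i j + ε * (+ 1 / 8) * (w i * h i)
  rounding-excess 0≤e (w∉ , h∉ , _) rounding@(big , wide , tall , small , _) j with dense? ε₁ ε₂ K i
  ... | yes isDense =
    ≤-trans (≤-reflexive (dense-rounding-unchanged rounding isDense j)) (p≤p+q (*-nonNeg 0≤e (*-nonNeg 0≤w 0≤h)))
  ... | no ¬dense with small-or-large w∉ | small-or-large h∉
  ...   | inj₂ ε₁<w | inj₂ ε₁<h = roundUp≤+scaled (0≤v j) 0≤e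
    (*-mono-≤-nonNeg 0≤ε₁ 0≤ε₁ (<⇒≤ ε₁<w) (<⇒≤ ε₁<h)) (big (ε₁<w , ε₁<h) j)
  ...   | inj₂ ε₁<w | inj₁ h≤ε₂ = roundUp≤+scaled (0≤v j) 0≤e
    (≤-trans (*-monoˡ-≤-nonNeg (h i) {{nonNegative 0≤h}} (<⇒≤ ε₁<w)) (≤-reflexive (*-comm (h i) (w i))))
    (wide (ε₁<w , h≤ε₂) ¬dense j)
  ...   | inj₁ w≤ε₂ | inj₂ ε₁<h = roundUp≤+scaled (0≤v j) 0≤e
    (*-monoˡ-≤-nonNeg (w i) {{nonNegative 0≤w}} (<⇒≤ ε₁<h)) (tall (w≤ε₂ , ε₁<h) ¬dense j)
  ...   | inj₁ w≤ε₂ | inj₁ h≤ε₂ = roundUp≤+scaled {s = w i * h i} (0≤v j) 0≤e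
    ≤-refl (small (w≤ε₂ , h≤ε₂) ¬dense j)

lemma48 : (d : ℕ) (ε ε₁ ε₂ : ℚ) (E E₁ E₂ : ℕ) →
    ε * ℕ→ℚ E ≡ 1ℚ → 2 ∣ E → ε₁ * ℕ→ℚ E₁ ≡ 1ℚ → ε₂ * ℕ→ℚ E₂ ≡ 1ℚ →
    ε ≤ + 1 / 8 →
    ε₁ ≤ + 1 / suc (4 ℕ.* d) → ε₁ ≤ (+ 2 / 3) * ε →
    ε₂ ≤ ε * ε₁ * ε₁ * ½ →
    (μ : ℚ) → ε * (+ 1 / 8) ≤ μ → μ ≤ ε →
    (n : ℕ) (J : Fin n → Item d) →
    (∀ i → ValidItem (J i)) →
    (∀ i → NonMedium ε₂ ε₁ (J i)) →
    Packing n J →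
    Slacked (ℕ→ℚ (E₁ ℕ.* E₁)) ε₁ ε₂ μ n J →
    (v' : Fin n → Fin d → ℚ) →
    (∀ i → Rounding ε ε₁ ε₂ (ℕ→ℚ (E₁ ℕ.* E₁)) (J i) (v' i)) →
    Slacked (ℕ→ℚ (E₁ ℕ.* E₁)) ε₁ ε₂ (μ - ε * (+ 1 / 8)) n
      (λ i → item (w (J i)) (h (J i)) (v' i))
lemma48 d ε ε₁ ε₂ E E₁ E₂ εE _ ε₁E₁ _ _ _ _ _ μ _ _ n J valid nonMedium packing slacked v′ rounding =
  Sum.map weights-slacked (Sum.map₂ (Product.map₂ (λ denseLight i →
    dense-light-rounding 0≤ε₁ 0≤K Kε₁²≡1 (valid i) (rounding i) (denseLight i)))) slacked
  where
  0≤ε₁ : 0ℚ ≤ ε₁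
  0≤ε₁ = p*n≡1⇒0≤p ε₁ E₁ ε₁E₁
  0≤K : 0ℚ ≤ ℕ→ℚ (E₁ ℕ.* E₁)
  0≤K = 0≤ℕ→ℚ (E₁ ℕ.* E₁)
  Kε₁²≡1 : ℕ→ℚ (E₁ ℕ.* E₁) * (ε₁ * ε₁) ≡ 1ℚ
  Kε₁²≡1 = p*n≡1⇒n²*p²≡1 ε₁ E₁ ε₁E₁
  0≤e : 0ℚ ≤ ε * (+ 1 / 8)
  0≤e = *-nonNeg (p*n≡1⇒0≤p ε E εE) (nonNegative⁻¹ (+ 1 / 8) {{normalize-nonNeg 1 8}})
  weights-slacked : (∀ j → ∑ n (λ i → v (J i) j) ≤ 1ℚ - μ) → ∀ j → ∑ n (λ i → v′ i j) ≤ 1ℚ - (μ - ε * (+ 1 / 8))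
  weights-slacked slack j = ∑-excess-≤ n {μ = μ} 0≤e
    (λ i → rounding-excess 0≤ε₁ 0≤K Kε₁²≡1 (valid i) 0≤e (nonMedium i) (rounding i) j)
    (slack j) (packing-area≤1 n J valid packing)
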